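{- $D(19,\{3,4\})\ge 34$; equivalently, every $\{K_3,K_4\}$-decomposition of $K_{19}$ contains at least $11$ copies of $K_3$.
   Context: A $\{K_3,K_4\}$-decomposition of $K_v$ is a collection of subgraphs of $K_v$, each isomorphic to $K_3$ or $K_4$, whose edge sets partition $E(K_v)$. $D(v,\{3,4\})$ denotes the minimum number of subgraphs in a $\{K_3,K_4\}$-decomposition of $K_v$. -}

module Defs where

open import Data.Nat using (ℕ; _≥_)
open import Data.Fin using (Fin)
open import Data.List using (List; length; filter)
open import Data.List.Relation.Unary.Unique.Propositional using (Unique)
open import Data.List.Membership.Propositional using (_∈_)
open import Data.List.Membership.DecPropositional using () renaming (_∈?_ to ∈?-gen)
open import Data.Fin.Properties using (_≟_)
open import Data.Product using (_×_)
open import Data.Sum using (_⊎_)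
open import Relation.Binary.PropositionalEquality using (_≡_)
open import Relation.Nullary using (¬_)
open import Relation.Nullary.Decidable using (_×-dec_)

-- A copy of K_3 or K_4 in K_v is given by its vertex set: a duplicate-free
-- list of 3 or 4 vertices of K_v (vertex set Fin v). Its edges are all
-- pairs of distinct vertices in the list.
record Clique (v : ℕ) : Set where
  constructor clique
  field
    verts    : List (Fin v)
    distinct : Unique verts
    size34   : length verts ≡ 3 ⊎ length verts ≡ 4
open Clique public

multiplicity : ∀ {v} → Fin v → Fin v → List (Clique v) → ℕ
multiplicity {v} x y Bs =
  length (filter (λ B → ∈?-gen _≟_ x (verts B) ×-dec ∈?-gen _≟_ y (verts B)) Bs)

IsDecomposition : ∀ {v} → List (Clique v) → Set
IsDecomposition {v} Bs = ∀ (x y : Fin v) → ¬ x ≡ y → multiplicity x y Bs ≡ 1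

DLowerBound : ℕ → ℕ → Set
DLowerBound v n = ∀ (Bs : List (Clique v)) → IsDecomposition Bs → length Bs ≥ n

-- Write b for the number of blocks, t for the number of triangles, r_y and t_y for the
-- numbers of blocks and of triangles through a vertex y, M for the set of vertices lying on
-- a triangle, m = |M| and j_B = |B ∩ M|. The edges at y give 3 r_y = 18 + t_y, so 3 ∣ t_y
-- and m ≤ t; summing over y gives 2b = 57 + t, so b ≤ 33 would force t ≤ 9 with t odd.
-- Counting the ordered pairs of distinct points of M block by block gives
-- Σ_B j_B (j_B − 1) = m (m − 1), and summing 3 r_y = 18 + t_y over M gives Σ_B j_B = t + 6m.
-- As j_B = 3 on triangles, j (j − 1) ≥ 0 and (j − 1)(j − 2) ≥ 0 on the K4s yield
-- 6t + m ≤ m² and 3t + 13m ≤ m² + 57; with m ≤ t ≤ 9 these force m = 0, hence t = 0,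
-- contradicting the parity of t.

{-# OPTIONS --safe #-}
module Submission where

open import Defs
open import Function using (_∘_)
open import Data.Bool using (true; false; if_then_else_)
open import Data.Nat using (ℕ; zero; suc; _+_; _*_; _≤_; _<_; _≥_; z≤n; s≤s)
open import Data.Nat.Properties hiding (_≟_)
open import Data.Nat.Divisibility using (_∣_; divides; ∣m+n∣m⇒∣n; ∣⇒≤)
open import Data.Nat.Tactic.RingSolver using (solve-∀)
open import Data.Fin using (Fin; zero; suc)
open import Data.Fin.Properties as Fin using (_≟_)
open import Data.List using (List; []; _∷_; length; lookup)
open import Data.List.Membership.Propositional using (_∈_)
open import Data.List.Membership.DecPropositional using () renaming (_∈?_ to ∈?-gen)
open import Data.List.Relation.Unary.All.Properties using (All¬⇒¬Any)
open import Data.List.Relation.Unary.Unique.Propositional using (Unique; []; _∷_)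
open import Data.Sum using (inj₁; inj₂)
open import Data.Empty using (⊥-elim)
open import Relation.Binary.PropositionalEquality using (_≡_; refl; sym; trans; cong; cong₂; subst; module ≡-Reasoning)
open import Relation.Nullary using (Dec; does; yes; no; ¬_)
open import Relation.Nullary.Decidable using (dec-true; dec-false)
open import Algebra.Properties.Semiring.Sum +-*-semiring
  using (sum; sum-syntax; sum-cong-≗; sum-replicate-zero; ∑-distrib-+; ∑-comm; *-distribˡ-sum; *-distribʳ-sum)

iverson : ∀ {p} {P : Set p} → Dec P → ℕ
iverson d = if does d then 1 else 0

iverson-idem : ∀ {p} {P : Set p} (d : Dec P) → iverson d * iverson d ≡ iverson d
iverson-idem d with does d
... | true  = refl
... | false = refl

sgn : ℕ → ℕ
sgn zero    = 0
sgn (suc _) = 1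

sgn-idem : ∀ n → sgn n * sgn n ≡ sgn n
sgn-idem zero    = refl
sgn-idem (suc _) = refl

sgn-≥1 : ∀ {n} → 1 ≤ n → sgn n ≡ 1
sgn-≥1 (s≤s _) = refl

∑-const-1 : ∀ n → ∑[ i < n ] 1 ≡ n
∑-const-1 zero    = refl
∑-const-1 (suc n) = cong suc (∑-const-1 n)

∑-mono-≤ : ∀ {n} {f g : Fin n → ℕ} → (∀ i → f i ≤ g i) → sum f ≤ sum g
∑-mono-≤ {zero}  f≤g = z≤n
∑-mono-≤ {suc n} f≤g = +-mono-≤ (f≤g zero) (∑-mono-≤ (f≤g ∘ suc))

term-≤-∑ : ∀ {n} (f : Fin n → ℕ) i → f i ≤ sum f
term-≤-∑ f zero    = m≤m+n _ _
term-≤-∑ f (suc i) = m≤n⇒m≤o+n (f zero) (term-≤-∑ (f ∘ suc) i)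

∑-iverson-≟ : ∀ {n} (x : Fin n) → ∑[ z < n ] iverson (z ≟ x) ≡ 1
∑-iverson-≟ {suc n} zero    = cong suc (sum-replicate-zero n)
∑-iverson-≟ {suc n} (suc x) = ∑-iverson-≟ x

∑-*-one-except : ∀ {n} (y : Fin n) (w g : Fin n → ℕ) → (∀ z → ¬ z ≡ y → g z ≡ 1) →
  ∑[ z < n ] (w z * g z) + w y ≡ sum w + w y * g y
∑-*-one-except {suc n} zero w g g≡1 = begin
  w zero * g zero + ∑[ z < n ] (w (suc z) * g (suc z)) + w zero
    ≡⟨ cong (λ s → w zero * g zero + s + w zero) (sum-cong-≗ λ z →
         trans (cong (w (suc z) *_) (g≡1 (suc z) λ ())) (*-identityʳ _)) ⟩
  w zero * g zero + sum (w ∘ suc) + w zero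
    ≡⟨ rotate (w zero * g zero) (sum (w ∘ suc)) (w zero) ⟩
  w zero + sum (w ∘ suc) + w zero * g zero ∎
  where
  open ≡-Reasoning
  rotate : ∀ a s b → a + s + b ≡ b + s + a
  rotate = solve-∀
∑-*-one-except {suc n} (suc y) w g g≡1 = begin
  w zero * g zero + ∑[ z < n ] (w (suc z) * g (suc z)) + w (suc y)
    ≡⟨ +-assoc (w zero * g zero) _ _ ⟩
  w zero * g zero + (∑[ z < n ] (w (suc z) * g (suc z)) + w (suc y))
    ≡⟨ cong₂ _+_ (cong (w zero *_) (g≡1 zero λ ())) (∑-*-one-except y (w ∘ suc) (g ∘ suc) (λ z z≢y → g≡1 (suc z) (z≢y ∘ Fin.suc-injective))) ⟩
  w zero * 1 + (sum (w ∘ suc) + w (suc y) * g (suc y))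
    ≡⟨ cong (_+ (sum (w ∘ suc) + w (suc y) * g (suc y))) (*-identityʳ (w zero)) ⟩
  w zero + (sum (w ∘ suc) + w (suc y) * g (suc y))
    ≡⟨ +-assoc (w zero) _ _ ⟨
  w zero + sum (w ∘ suc) + w (suc y) * g (suc y) ∎
  where
  open ≡-Reasoning

_∈?_ : ∀ {v} (x : Fin v) (xs : List (Fin v)) → Dec (x ∈ xs)
x ∈? xs = ∈?-gen _≟_ x xs

incidence : ∀ {v} → Fin v → Clique v → ℕ
incidence x B = iverson (x ∈? verts B)

weight : ∀ {v} → (Fin v → ℕ) → Clique v → ℕ
weight {v} w B = ∑[ z < v ] (incidence z B * w z)

incidence-∈ : ∀ {v} {x : Fin v} {B : Clique v} → x ∈ verts B → incidence x B ≡ 1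
incidence-∈ {x = x} {B} x∈B = cong (if_then 1 else 0) (dec-true (x ∈? verts B) x∈B)

iverson-∈-∷ : ∀ {v} (z x : Fin v) (xs : List (Fin v)) → ¬ x ∈ xs →
  iverson (z ∈? (x ∷ xs)) ≡ iverson (z ≟ x) + iverson (z ∈? xs)
iverson-∈-∷ z x xs x∉xs with z ≟ x
... | yes refl rewrite dec-false (z ∈? xs) x∉xs = refl
... | no _     = refl

∑-iverson-∈ : ∀ {v} {xs : List (Fin v)} → Unique xs → ∑[ z < v ] iverson (z ∈? xs) ≡ length xs
∑-iverson-∈ {v} [] = sum-replicate-zero v
∑-iverson-∈ {v} {x ∷ xs} (x∉xs ∷ unique) = begin
  ∑[ z < v ] iverson (z ∈? (x ∷ xs))
    ≡⟨ sum-cong-≗ (λ z → iverson-∈-∷ z x xs (All¬⇒¬Any x∉xs)) ⟩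
  ∑[ z < v ] (iverson (z ≟ x) + iverson (z ∈? xs))
    ≡⟨ ∑-distrib-+ (λ z → iverson (z ≟ x)) _ ⟩
  ∑[ z < v ] iverson (z ≟ x) + ∑[ z < v ] iverson (z ∈? xs)
    ≡⟨ cong₂ _+_ (∑-iverson-≟ x) (∑-iverson-∈ unique) ⟩
  suc (length xs) ∎
  where open ≡-Reasoning

weight-full : ∀ {v} (w : Fin v → ℕ) (B : Clique v) → (∀ z → z ∈ verts B → w z ≡ 1) →
  weight w B ≡ length (verts B)
weight-full w B full = trans (sum-cong-≗ incidence-absorbs) (∑-iverson-∈ (distinct B))
  where
  incidence-absorbs : ∀ z → incidence z B * w z ≡ incidence z B
  incidence-absorbs z with z ∈? verts B
  ... | yes z∈B = trans (+-identityʳ (w z)) (full z z∈B)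
  ... | no  _   = refl

multiplicity-≡-∑ : ∀ {v} (x y : Fin v) (Bs : List (Clique v)) →
  multiplicity x y Bs ≡ ∑[ i < length Bs ] (incidence x (lookup Bs i) * incidence y (lookup Bs i))
multiplicity-≡-∑ x y [] = refl
multiplicity-≡-∑ x y (B ∷ Bs) with does (x ∈? verts B) | does (y ∈? verts B)
... | true  | true  = cong suc (multiplicity-≡-∑ x y Bs)
... | true  | false = multiplicity-≡-∑ x y Bs
... | false | _     = multiplicity-≡-∑ x y Bs

isTriangle : ∀ {v} → Clique v → ℕ
isTriangle (clique _ _ (inj₁ _)) = 1
isTriangle (clique _ _ (inj₂ _)) = 0

length+isTriangle : ∀ {v} (B : Clique v) → length (verts B) + isTriangle B ≡ 4
length+isTriangle (clique _ _ (inj₁ |B|≡3)) = cong (_+ 1) |B|≡3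
length+isTriangle (clique _ _ (inj₂ |B|≡4)) = cong (_+ 0) |B|≡4

weight-triangle : ∀ {v} (w : Fin v → ℕ) (B : Clique v) → (∀ z → z ∈ verts B → w z ≡ 1) →
  isTriangle B ≡ 1 → weight w B ≡ 3
weight-triangle w B@(clique _ _ (inj₁ |B|≡3)) full _ = trans (weight-full w B full) |B|≡3
weight-triangle w (clique _ _ (inj₂ _)) _ ()

n≤n*n : ∀ n → n ≤ n * n
n≤n*n zero      = z≤n
n≤n*n n@(suc _) = m≤m*n n n

3n≤n*n+2 : ∀ n → 3 * n ≤ n * n + 2
3n≤n*n+2 0 = z≤n
3n≤n*n+2 1 = ≤-refl
3n≤n*n+2 2 = ≤-refl
3n≤n*n+2 n@(suc (suc (suc _))) = m≤n⇒m≤n+o 2 (*-monoˡ-≤ n {3} {n} (s≤s (s≤s (s≤s z≤n))))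

*-isTriangle : ∀ {v} (B : Clique v) n → (isTriangle B ≡ 1 → n ≡ 3) → n * isTriangle B ≡ 3 * isTriangle B
*-isTriangle (clique _ _ (inj₁ _)) n n≡3 = trans (*-identityʳ n) (n≡3 refl)
*-isTriangle (clique _ _ (inj₂ _)) n _   = *-zeroʳ n

triangle-pair-bound : ∀ {v} (B : Clique v) n → (isTriangle B ≡ 1 → n ≡ 3) → n + 6 * isTriangle B ≤ n * n
triangle-pair-bound (clique _ _ (inj₁ _)) n n≡3 rewrite n≡3 refl = ≤-refl
triangle-pair-bound (clique _ _ (inj₂ _)) n _ rewrite +-identityʳ n = n≤n*n n

quadratic-bound : ∀ {v} (B : Clique v) n → (isTriangle B ≡ 1 → n ≡ 3) → 3 * n + 2 * isTriangle B ≤ n * n + 2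
quadratic-bound (clique _ _ (inj₁ _)) n n≡3 rewrite n≡3 refl = ≤-refl
quadratic-bound (clique _ _ (inj₂ _)) n _ rewrite +-identityʳ (3 * n) = 3n≤n*n+2 n

module Counting {v : ℕ} (Bs : List (Clique v)) where

  block : Fin (length Bs) → Clique v
  block = lookup Bs

  ∑ᴮ : (Clique v → ℕ) → ℕ
  ∑ᴮ g = ∑[ i < length Bs ] g (block i)

  replication : Fin v → ℕ
  replication y = ∑ᴮ (incidence y)

  triangles : ℕ
  triangles = ∑ᴮ isTriangle

  trianglesAt : Fin v → ℕ
  trianglesAt y = ∑ᴮ (λ B → incidence y B * isTriangle B)

  ∑-incidence-swap : ∀ (u : Fin v → ℕ) (g : Clique v → ℕ) →
    ∑[ y < v ] (u y * ∑ᴮ (λ B → incidence y B * g B)) ≡ ∑ᴮ (λ B → weight u B * g B)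
  ∑-incidence-swap u g = begin
    ∑[ y < v ] (u y * ∑ᴮ (λ B → incidence y B * g B))
      ≡⟨ sum-cong-≗ (λ y → *-distribˡ-sum (u y) (λ i → incidence y (block i) * g (block i))) ⟩
    ∑[ y < v ] ∑ᴮ (λ B → u y * (incidence y B * g B))
      ≡⟨ ∑-comm (λ y i → u y * (incidence y (block i) * g (block i))) ⟩
    ∑ᴮ (λ B → ∑[ y < v ] (u y * (incidence y B * g B)))
      ≡⟨ sum-cong-≗ (λ i → trans (sum-cong-≗ (λ y → rearrange (u y) (incidence y (block i)) (g (block i))))
                                  (sym (*-distribʳ-sum (g (block i)) (λ y → incidence y (block i) * u y)))) ⟩
    ∑ᴮ (λ B → weight u B * g B) ∎
    where
    open ≡-Reasoning
    rearrange : ∀ a b c → a * (b * c) ≡ b * a * c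
    rearrange = solve-∀

  ∑-replication : ∀ (u : Fin v → ℕ) → ∑[ y < v ] (u y * replication y) ≡ ∑ᴮ (weight u)
  ∑-replication u = begin
    ∑[ y < v ] (u y * replication y)
      ≡⟨ sum-cong-≗ (λ y → cong (u y *_) (sum-cong-≗ (λ i → *-identityʳ (incidence y (block i))))) ⟨
    ∑[ y < v ] (u y * ∑ᴮ (λ B → incidence y B * 1))
      ≡⟨ ∑-incidence-swap u (λ _ → 1) ⟩
    ∑ᴮ (λ B → weight u B * 1)
      ≡⟨ sum-cong-≗ (λ i → *-identityʳ (weight u (block i))) ⟩
    ∑ᴮ (weight u) ∎
    where open ≡-Reasoning

  ∑-trianglesAt : ∀ (u : Fin v → ℕ) →
    (∀ i → isTriangle (block i) ≡ 1 → ∀ z → z ∈ verts (block i) → u z ≡ 1) →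
    ∑[ y < v ] (u y * trianglesAt y) ≡ 3 * triangles
  ∑-trianglesAt u full = begin
    ∑[ y < v ] (u y * trianglesAt y)
      ≡⟨ ∑-incidence-swap u isTriangle ⟩
    ∑ᴮ (λ B → weight u B * isTriangle B)
      ≡⟨ sum-cong-≗ (λ i → *-isTriangle (block i) _ λ t → weight-triangle u (block i) (full i t) t) ⟩
    ∑ᴮ (λ B → 3 * isTriangle B)
      ≡⟨ *-distribˡ-sum 3 (isTriangle ∘ block) ⟨
    3 * triangles ∎
    where open ≡-Reasoning

  ∑-length+triangles : ∑ᴮ (λ B → length (verts B)) + triangles ≡ 4 * length Bs
  ∑-length+triangles = begin
    ∑ᴮ (λ B → length (verts B)) + triangles
      ≡⟨ ∑-distrib-+ (λ i → length (verts (block i))) (isTriangle ∘ block) ⟨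
    ∑ᴮ (λ B → length (verts B) + isTriangle B)
      ≡⟨ sum-cong-≗ (λ i → length+isTriangle (block i)) ⟩
    ∑[ i < length Bs ] 4
      ≡⟨ *-distribˡ-sum {length Bs} 4 (λ _ → 1) ⟨
    4 * ∑[ i < length Bs ] 1
      ≡⟨ cong (4 *_) (∑-const-1 (length Bs)) ⟩
    4 * length Bs ∎
    where open ≡-Reasoning

  ∑-length-at+trianglesAt : ∀ y →
    ∑ᴮ (λ B → incidence y B * length (verts B)) + trianglesAt y ≡ 4 * replication y
  ∑-length-at+trianglesAt y = begin
    ∑ᴮ (λ B → incidence y B * length (verts B)) + trianglesAt y
      ≡⟨ ∑-distrib-+ (λ i → incidence y (block i) * length (verts (block i))) (λ i → incidence y (block i) * isTriangle (block i)) ⟨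
    ∑ᴮ (λ B → incidence y B * length (verts B) + incidence y B * isTriangle B)
      ≡⟨ sum-cong-≗ (λ i → trans (sym (*-distribˡ-+ (incidence y (block i)) _ _)) (cong (incidence y (block i) *_) (length+isTriangle (block i)))) ⟩
    ∑ᴮ (λ B → incidence y B * 4)
      ≡⟨ sum-cong-≗ (λ i → *-comm (incidence y (block i)) 4) ⟩
    ∑ᴮ (λ B → 4 * incidence y B)
      ≡⟨ *-distribˡ-sum {length Bs} 4 (λ i → incidence y (block i)) ⟨
    4 * replication y ∎
    where open ≡-Reasoning

  multiplicity-diag : ∀ y → multiplicity y y Bs ≡ replication y
  multiplicity-diag y = trans (multiplicity-≡-∑ y y Bs) (sum-cong-≗ (λ i → iverson-idem (y ∈? verts (block i))))

  module _ (isDec : IsDecomposition Bs) where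

    -- Every z ≠ y shares exactly one block with y.
    row-identity : ∀ y (w : Fin v → ℕ) →
      ∑ᴮ (λ B → incidence y B * weight w B) + w y ≡ sum w + w y * replication y
    row-identity y w = begin
      ∑ᴮ (λ B → incidence y B * weight w B) + w y
        ≡⟨ cong (_+ w y) (sum-cong-≗ (λ i → *-comm (incidence y (block i)) (weight w (block i)))) ⟩
      ∑ᴮ (λ B → weight w B * incidence y B) + w y
        ≡⟨ cong (_+ w y) (∑-incidence-swap w (incidence y)) ⟨
      ∑[ z < v ] (w z * ∑ᴮ (λ B → incidence z B * incidence y B)) + w y
        ≡⟨ cong (_+ w y) (sum-cong-≗ (λ z → cong (w z *_) (multiplicity-≡-∑ z y Bs))) ⟨
      ∑[ z < v ] (w z * multiplicity z y Bs) + w y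
        ≡⟨ ∑-*-one-except y w (λ z → multiplicity z y Bs) (λ z z≢y → isDec z y z≢y) ⟩
      sum w + w y * multiplicity y y Bs
        ≡⟨ cong (λ r → sum w + w y * r) (multiplicity-diag y) ⟩
      sum w + w y * replication y ∎
      where open ≡-Reasoning

    pair-identity : ∀ (u w : Fin v → ℕ) →
      ∑ᴮ (λ B → weight u B * weight w B) + ∑[ y < v ] (u y * w y)
        ≡ sum u * sum w + ∑ᴮ (weight (λ y → u y * w y))
    pair-identity u w = begin
      ∑ᴮ (λ B → weight u B * weight w B) + ∑[ y < v ] (u y * w y)
        ≡⟨ cong (_+ ∑[ y < v ] (u y * w y)) (∑-incidence-swap u (weight w)) ⟨
      ∑[ y < v ] (u y * ∑ᴮ (λ B → incidence y B * weight w B)) + ∑[ y < v ] (u y * w y)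
        ≡⟨ ∑-distrib-+ (λ y → u y * ∑ᴮ (λ B → incidence y B * weight w B)) (λ y → u y * w y) ⟨
      ∑[ y < v ] (u y * ∑ᴮ (λ B → incidence y B * weight w B) + u y * w y)
        ≡⟨ sum-cong-≗ (λ y → trans (sym (*-distribˡ-+ (u y) _ (w y))) (cong (u y *_) (row-identity y w))) ⟩
      ∑[ y < v ] (u y * (sum w + w y * replication y))
        ≡⟨ sum-cong-≗ (λ y → expand (u y) (sum w) (w y) (replication y)) ⟩
      ∑[ y < v ] (u y * sum w + u y * w y * replication y)
        ≡⟨ ∑-distrib-+ (λ y → u y * sum w) (λ y → u y * w y * replication y) ⟩
      ∑[ y < v ] (u y * sum w) + ∑[ y < v ] (u y * w y * replication y)
        ≡⟨ cong₂ _+_ (sym (*-distribʳ-sum (sum w) u)) (∑-replication (λ y → u y * w y)) ⟩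
      sum u * sum w + ∑ᴮ (weight (λ y → u y * w y)) ∎
      where
      open ≡-Reasoning
      expand : ∀ a s b r → a * (s + b * r) ≡ a * s + a * b * r
      expand = solve-∀

    ∑-length-at : ∀ y → ∑ᴮ (λ B → incidence y B * length (verts B)) + 1 ≡ v + replication y
    ∑-length-at y = begin
      ∑ᴮ (λ B → incidence y B * length (verts B)) + 1
        ≡⟨ cong (_+ 1) (sum-cong-≗ (λ i → cong (incidence y (block i) *_) (weight-full (λ _ → 1) (block i) (λ _ _ → refl)))) ⟨
      ∑ᴮ (λ B → incidence y B * weight (λ _ → 1) B) + 1
        ≡⟨ row-identity y (λ _ → 1) ⟩
      ∑[ z < v ] 1 + 1 * replication y
        ≡⟨ cong₂ _+_ (∑-const-1 v) (*-identityˡ (replication y)) ⟩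
      v + replication y ∎
      where open ≡-Reasoning

    degree-identity : ∀ y → 3 * replication y + 1 ≡ v + trianglesAt y
    degree-identity y = +-cancelˡ-≡ L _ _ (begin
      L + (3 * replication y + 1)
        ≡⟨ regroup L (replication y) ⟩
      (L + 1) + 3 * replication y
        ≡⟨ cong (_+ 3 * replication y) (∑-length-at y) ⟩
      (v + replication y) + 3 * replication y
        ≡⟨ regroup′ v (replication y) ⟩
      v + 4 * replication y
        ≡⟨ cong (v +_) (∑-length-at+trianglesAt y) ⟨
      v + (L + trianglesAt y)
        ≡⟨ +-comm-middle v L (trianglesAt y) ⟩
      L + (v + trianglesAt y) ∎)
      where
      open ≡-Reasoning
      L : ℕ
      L = ∑ᴮ (λ B → incidence y B * length (verts B))
      regroup : ∀ a r → a + (3 * r + 1) ≡ (a + 1) + 3 * r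
      regroup = solve-∀
      regroup′ : ∀ a r → (a + r) + 3 * r ≡ a + 4 * r
      regroup′ = solve-∀
      +-comm-middle : ∀ a b c → a + (b + c) ≡ b + (a + c)
      +-comm-middle = solve-∀

    weighted-degree : ∀ (u : Fin v → ℕ) →
      3 * ∑ᴮ (weight u) + sum u ≡ v * sum u + ∑[ y < v ] (u y * trianglesAt y)
    weighted-degree u = begin
      3 * ∑ᴮ (weight u) + sum u
        ≡⟨ cong (λ s → 3 * s + sum u) (∑-replication u) ⟨
      3 * ∑[ y < v ] (u y * replication y) + sum u
        ≡⟨ cong (_+ sum u) (*-distribˡ-sum 3 (λ y → u y * replication y)) ⟩
      ∑[ y < v ] (3 * (u y * replication y)) + sum u
        ≡⟨ ∑-distrib-+ (λ y → 3 * (u y * replication y)) u ⟨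
      ∑[ y < v ] (3 * (u y * replication y) + u y)
        ≡⟨ sum-cong-≗ (λ y → trans (factor (u y) (replication y)) (cong (u y *_) (degree-identity y))) ⟩
      ∑[ y < v ] (u y * (v + trianglesAt y))
        ≡⟨ sum-cong-≗ (λ y → *-distribˡ-+ (u y) v (trianglesAt y)) ⟩
      ∑[ y < v ] (u y * v + u y * trianglesAt y)
        ≡⟨ ∑-distrib-+ (λ y → u y * v) (λ y → u y * trianglesAt y) ⟩
      ∑[ y < v ] (u y * v) + ∑[ y < v ] (u y * trianglesAt y)
        ≡⟨ cong (_+ ∑[ y < v ] (u y * trianglesAt y)) (trans (sym (*-distribʳ-sum v u)) (*-comm (sum u) v)) ⟩
      v * sum u + ∑[ y < v ] (u y * trianglesAt y) ∎
      where
      open ≡-Reasoning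
      factor : ∀ a r → 3 * (a * r) + a ≡ a * (3 * r + 1)
      factor = solve-∀

    blocks-count : 12 * length Bs + v ≡ v * v + 6 * triangles
    blocks-count = begin
      12 * length Bs + v                     ≡⟨ cong (_+ v) (*-assoc 3 4 (length Bs)) ⟩
      3 * (4 * length Bs) + v                ≡⟨ cong (λ n → 3 * n + v) ∑-length+triangles ⟨
      3 * (L + triangles) + v                ≡⟨ regroup L triangles v ⟩
      (3 * L + v) + 3 * triangles            ≡⟨ cong (_+ 3 * triangles) degree-sum ⟩
      v * v + 3 * triangles + 3 * triangles  ≡⟨ collect (v * v) triangles ⟩
      v * v + 6 * triangles                  ∎
      where
      open ≡-Reasoning
      L : ℕ
      L = ∑ᴮ (λ B → length (verts B))
      degree-sum : 3 * L + v ≡ v * v + 3 * triangles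
      degree-sum = begin
        3 * L + v
          ≡⟨ cong₂ (λ s n → 3 * s + n) (sum-cong-≗ (λ i → weight-full (λ _ → 1) (block i) (λ _ _ → refl))) (∑-const-1 v) ⟨
        3 * ∑ᴮ (weight (λ _ → 1)) + ∑[ z < v ] 1
          ≡⟨ weighted-degree (λ _ → 1) ⟩
        v * ∑[ z < v ] 1 + ∑[ y < v ] (1 * trianglesAt y)
          ≡⟨ cong₂ (λ n s → v * n + s) (∑-const-1 v) (∑-trianglesAt (λ _ → 1) (λ _ _ _ _ → refl)) ⟩
        v * v + 3 * triangles ∎
      regroup : ∀ s t v → 3 * (s + t) + v ≡ (3 * s + v) + 3 * t
      regroup = solve-∀
      collect : ∀ a t → a + 3 * t + 3 * t ≡ a + 6 * t
      collect = solve-∀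

3∣-of-degree : ∀ {r a} → 3 * r + 1 ≡ 19 + a → 3 ∣ a
3∣-of-degree {r} {a} e = ∣m+n∣m⇒∣n (divides r (trans (sym 3r≡18+a) (*-comm 3 r))) (divides 6 refl)
  where
  3r≡18+a : 3 * r ≡ 18 + a
  3r≡18+a = suc-injective (trans (+-comm 1 (3 * r)) e)

3∣⇒3*sgn≤ : ∀ {a} → 3 ∣ a → 3 * sgn a ≤ a
3∣⇒3*sgn≤ {zero}  _   = z≤n
3∣⇒3*sgn≤ {suc _} 3∣a = ∣⇒≤ 3∣a

blocks-from-triangles : ∀ {b t} → 12 * b + 19 ≡ 19 * 19 + 6 * t → 2 * b ≡ 57 + t
blocks-from-triangles {b} {t} e = *-cancelˡ-≡ (2 * b) (57 + t) 6 (+-cancelʳ-≡ 19 _ _ (begin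
  6 * (2 * b) + 19    ≡⟨ cong (_+ 19) (*-assoc 6 2 b) ⟨
  12 * b + 19         ≡⟨ e ⟩
  19 * 19 + 6 * t     ≡⟨ split t ⟩
  6 * (57 + t) + 19   ∎))
  where
  open ≡-Reasoning
  split : ∀ t → 19 * 19 + 6 * t ≡ 6 * (57 + t) + 19
  split = solve-∀

J-from-degrees : ∀ {J m t} → 3 * J + m ≡ 19 * m + 3 * t → J ≡ t + 6 * m
J-from-degrees {J} {m} {t} e = *-cancelˡ-≡ J (t + 6 * m) 3 (+-cancelʳ-≡ m _ _ (trans e (split m t)))
  where
  split : ∀ m t → 19 * m + 3 * t ≡ 3 * (t + 6 * m) + m
  split = solve-∀

triangle-pairs-in-M : ∀ {t m J Q} → Q + m ≡ m * m + J → J + 6 * t ≤ Q → 6 * t + m ≤ m * m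
triangle-pairs-in-M {t} {m} {J} {Q} pairs J+6t≤Q = +-cancelˡ-≤ J _ _ (begin
  J + (6 * t + m)   ≡⟨ +-assoc J (6 * t) m ⟨
  J + 6 * t + m     ≤⟨ +-monoˡ-≤ m J+6t≤Q ⟩
  Q + m             ≡⟨ pairs ⟩
  m * m + J         ≡⟨ +-comm (m * m) J ⟩
  J + m * m         ∎)
  where open ≤-Reasoning

K4-pairs-in-M : ∀ {b t m J Q} → 2 * b ≡ 57 + t → J ≡ t + 6 * m → Q + m ≡ m * m + J →
  3 * J + 2 * t ≤ Q + 2 * b → 3 * t + 13 * m ≤ m * m + 57
K4-pairs-in-M {b} {t} {m} {J} {Q} 2b≡57+t J≡t+6m pairs 3J+2t≤Q+2b = +-cancelˡ-≤ (J + t) _ _ (begin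
  J + t + (3 * t + 13 * m)         ≡⟨ expand J t m ⟩
  J + 2 * (t + 6 * m) + 2 * t + m  ≡⟨ cong (λ x → J + 2 * x + 2 * t + m) J≡t+6m ⟨
  J + 2 * J + 2 * t + m            ≡⟨ collect J t m ⟩
  3 * J + 2 * t + m                ≤⟨ +-monoˡ-≤ m 3J+2t≤Q+2b ⟩
  Q + 2 * b + m                    ≡⟨ +-comm-middle Q (2 * b) m ⟩
  (Q + m) + 2 * b                  ≡⟨ cong₂ _+_ pairs 2b≡57+t ⟩
  m * m + J + (57 + t)             ≡⟨ regroup (m * m) J t ⟩
  J + t + (m * m + 57)             ∎)
  where
  open ≤-Reasoning
  expand : ∀ J t m → J + t + (3 * t + 13 * m) ≡ J + 2 * (t + 6 * m) + 2 * t + m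
  expand = solve-∀
  collect : ∀ J t m → J + 2 * J + 2 * t + m ≡ 3 * J + 2 * t + m
  collect = solve-∀
  +-comm-middle : ∀ a b c → a + b + c ≡ (a + c) + b
  +-comm-middle = solve-∀
  regroup : ∀ s J t → s + J + (57 + t) ≡ J + t + (s + 57)
  regroup = solve-∀

quadratic-bounds⇒≡0 : ∀ m → m ≤ 9 → 7 * m ≤ m * m → 16 * m ≤ m * m + 57 → m ≡ 0
quadratic-bounds⇒≡0 0 _ _ _ = refl
quadratic-bounds⇒≡0 1 _ h _ = ⊥-elim (≤⇒≤ᵇ h)
quadratic-bounds⇒≡0 2 _ h _ = ⊥-elim (≤⇒≤ᵇ h)
quadratic-bounds⇒≡0 3 _ h _ = ⊥-elim (≤⇒≤ᵇ h)
quadratic-bounds⇒≡0 4 _ h _ = ⊥-elim (≤⇒≤ᵇ h)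
quadratic-bounds⇒≡0 5 _ h _ = ⊥-elim (≤⇒≤ᵇ h)
quadratic-bounds⇒≡0 6 _ h _ = ⊥-elim (≤⇒≤ᵇ h)
quadratic-bounds⇒≡0 7 _ _ h = ⊥-elim (≤⇒≤ᵇ h)
quadratic-bounds⇒≡0 8 _ _ h = ⊥-elim (≤⇒≤ᵇ h)
quadratic-bounds⇒≡0 9 _ _ h = ⊥-elim (≤⇒≤ᵇ h)
quadratic-bounds⇒≡0 (suc (suc (suc (suc (suc (suc (suc (suc (suc (suc _)))))))))) h _ _ = ⊥-elim (≤⇒≤ᵇ h)

few-triangles⇒no-triangles : ∀ {t m} → m ≤ t → t ≤ 9 → 6 * t + m ≤ m * m → 3 * t + 13 * m ≤ m * m + 57 → t ≡ 0
few-triangles⇒no-triangles {t} {m} m≤t t≤9 pairs K4-pairs = n≤0⇒n≡0 (begin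
  t              ≤⟨ m≤n*m t 6 ⟩
  6 * t          ≤⟨ m≤m+n (6 * t) 0 ⟩
  6 * t + 0      ≤⟨ subst (λ k → 6 * t + k ≤ k * k) m≡0 pairs ⟩
  0              ∎)
  where
  open ≤-Reasoning
  m≡0 : m ≡ 0
  m≡0 = quadratic-bounds⇒≡0 m (≤-trans m≤t t≤9)
    (begin
      7 * m          ≡⟨ +-comm m (6 * m) ⟩
      6 * m + m      ≤⟨ +-monoˡ-≤ m (*-monoʳ-≤ 6 m≤t) ⟩
      6 * t + m      ≤⟨ pairs ⟩
      m * m          ∎)
    (begin
      16 * m         ≡⟨ *-distribʳ-+ m 3 13 ⟩
      3 * m + 13 * m ≤⟨ +-monoˡ-≤ (13 * m) (*-monoʳ-≤ 3 m≤t) ⟩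
      3 * t + 13 * m ≤⟨ K4-pairs ⟩
      m * m + 57     ∎)

size-bound : ∀ {b t m J Q} → 12 * b + 19 ≡ 19 * 19 + 6 * t → 3 * J + m ≡ 19 * m + 3 * t →
  Q + m ≡ m * m + J → J + 6 * t ≤ Q → 3 * J + 2 * t ≤ Q + 2 * b → m ≤ t → b ≥ 34
size-bound {b} {t} {m} {J} {Q} blocks J-count pairs J+6t≤Q 3J+2t≤Q+2b m≤t = ≮⇒≥ λ b<34 →
  even≢odd b 28 (trans 2b≡57+t (cong (57 +_) (t≡0 b<34)))
  where
  2b≡57+t : 2 * b ≡ 57 + t
  2b≡57+t = blocks-from-triangles {b} {t} blocks
  t≡0 : b < 34 → t ≡ 0
  t≡0 b<34 = few-triangles⇒no-triangles m≤t
    (+-cancelˡ-≤ 57 t 9 (subst (_≤ 66) 2b≡57+t (*-monoʳ-≤ 2 (≤-pred b<34))))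
    (triangle-pairs-in-M {t} {m} {J} {Q} pairs J+6t≤Q)
    (K4-pairs-in-M {b} {t} {m} {J} {Q} 2b≡57+t (J-from-degrees {J} {m} {t} J-count) pairs 3J+2t≤Q+2b)

module DecompositionOfK19 (Bs : List (Clique 19)) (isDec : IsDecomposition Bs) where
  open Counting Bs

  onTriangle : Fin 19 → ℕ
  onTriangle y = sgn (trianglesAt y)

  -- onTriangle is the indicator of M; m = |M|, J = Σ_B j_B and Q = Σ_B j_B².
  m J Q : ℕ
  m = sum onTriangle
  J = ∑ᴮ (weight onTriangle)
  Q = ∑ᴮ (λ B → weight onTriangle B * weight onTriangle B)

  triangle-vertex-onTriangle : ∀ i → isTriangle (block i) ≡ 1 → ∀ z → z ∈ verts (block i) → onTriangle z ≡ 1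
  triangle-vertex-onTriangle i isT z z∈B = sgn-≥1 (subst (_≤ trianglesAt z) (cong₂ _*_ (incidence-∈ {B = block i} z∈B) isT)
    (term-≤-∑ (λ k → incidence z (block k) * isTriangle (block k)) i))

  weight-onTriangle : ∀ i → isTriangle (block i) ≡ 1 → weight onTriangle (block i) ≡ 3
  weight-onTriangle i isT = weight-triangle onTriangle (block i) (triangle-vertex-onTriangle i isT) isT

  J-count : 3 * J + m ≡ 19 * m + 3 * triangles
  J-count = trans (weighted-degree isDec onTriangle) (cong (19 * m +_) (∑-trianglesAt onTriangle triangle-vertex-onTriangle))

  pair-count : Q + m ≡ m * m + J
  pair-count = begin
    Q + m
      ≡⟨ cong (Q +_) (sum-cong-≗ (λ y → sgn-idem (trianglesAt y))) ⟨
    Q + ∑[ y < 19 ] (onTriangle y * onTriangle y)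
      ≡⟨ pair-identity isDec onTriangle onTriangle ⟩
    m * m + ∑ᴮ (weight (λ y → onTriangle y * onTriangle y))
      ≡⟨ cong (m * m +_) (sum-cong-≗ λ i → sum-cong-≗ λ z → cong (incidence z (block i) *_) (sgn-idem (trianglesAt z))) ⟩
    m * m + J ∎
    where open ≡-Reasoning

  J+6t≤Q : J + 6 * triangles ≤ Q
  J+6t≤Q = begin
    J + 6 * triangles
      ≡⟨ cong (J +_) (*-distribˡ-sum 6 (isTriangle ∘ block)) ⟩
    J + ∑ᴮ (λ B → 6 * isTriangle B)
      ≡⟨ ∑-distrib-+ (weight onTriangle ∘ block) (λ i → 6 * isTriangle (block i)) ⟨
    ∑ᴮ (λ B → weight onTriangle B + 6 * isTriangle B)
      ≤⟨ ∑-mono-≤ (λ i → triangle-pair-bound (block i) _ (weight-onTriangle i)) ⟩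
    Q ∎
    where open ≤-Reasoning

  3J+2t≤Q+2b : 3 * J + 2 * triangles ≤ Q + 2 * length Bs
  3J+2t≤Q+2b = begin
    3 * J + 2 * triangles
      ≡⟨ cong₂ _+_ (*-distribˡ-sum 3 (weight onTriangle ∘ block)) (*-distribˡ-sum 2 (isTriangle ∘ block)) ⟩
    ∑ᴮ (λ B → 3 * weight onTriangle B) + ∑ᴮ (λ B → 2 * isTriangle B)
      ≡⟨ ∑-distrib-+ (λ i → 3 * weight onTriangle (block i)) (λ i → 2 * isTriangle (block i)) ⟨
    ∑ᴮ (λ B → 3 * weight onTriangle B + 2 * isTriangle B)
      ≤⟨ ∑-mono-≤ (λ i → quadratic-bound (block i) _ (weight-onTriangle i)) ⟩
    ∑ᴮ (λ B → weight onTriangle B * weight onTriangle B + 2)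
      ≡⟨ ∑-distrib-+ (λ i → weight onTriangle (block i) * weight onTriangle (block i)) (λ _ → 2) ⟩
    Q + ∑[ i < length Bs ] 2
      ≡⟨ cong (Q +_) (trans (sym (*-distribˡ-sum {length Bs} 2 (λ _ → 1))) (cong (2 *_) (∑-const-1 (length Bs)))) ⟩
    Q + 2 * length Bs ∎
    where open ≤-Reasoning

  m≤triangles : m ≤ triangles
  m≤triangles = *-cancelˡ-≤ 3 (begin
    3 * m
      ≡⟨ *-distribˡ-sum 3 onTriangle ⟩
    ∑[ y < 19 ] (3 * onTriangle y)
      ≤⟨ ∑-mono-≤ (λ y → 3∣⇒3*sgn≤ (3∣-of-degree {replication y} (degree-identity isDec y))) ⟩
    ∑[ y < 19 ] trianglesAt y
      ≡⟨ sum-cong-≗ (λ y → *-identityˡ (trianglesAt y)) ⟨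
    ∑[ y < 19 ] (1 * trianglesAt y)
      ≡⟨ ∑-trianglesAt (λ _ → 1) (λ _ _ _ _ → refl) ⟩
    3 * triangles ∎)
    where open ≤-Reasoning

lemma30 : DLowerBound 19 34
lemma30 Bs isDec = size-bound (blocks-count isDec) J-count pair-count J+6t≤Q 3J+2t≤Q+2b m≤triangles
  where
  open DecompositionOfK19 Bs isDec
  open Counting Bs
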